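{- Let $L$ be a field of characteristic $p$, let $d\ge 2$ be an integer, let $\alpha_1,\alpha_2,\beta\in L$, and for $\lambda\in\overline{L}$ let $f_\lambda(z)=z^d+\lambda$. Let $C(\alpha_1,\alpha_2;\beta)$ be the set of all $\lambda\in\overline{L}$ for which there exist $m,n\in\mathbb{N}$ with $f_\lambda^m(\alpha_1)=f_\lambda^n(\alpha_2)=\beta$. If $\lambda\in C(\alpha_1,\alpha_2;\beta)$, then $\lambda\in\overline{\mathbb{F}_p(\alpha_1,\beta)}\cap\overline{\mathbb{F}_p(\alpha_2,\beta)}$.
   Context: $\mathbb{N}$ denotes the set of positive integers; $\overline{L}$ is an algebraic closure of $L$; for a subfield $K\subseteq \overline{L}$, $\overline{K}$ denotes its algebraic closure inside $\overline{L}$; $f_\lambda^n$ is the $n$-th compositional iterate of $f_\lambda$. -}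

module Defs where

open import Level using (Level; _⊔_) renaming (suc to lsuc)
open import Algebra.Bundles using (CommutativeRing)
open import Relation.Nullary using (¬_)
open import Data.Product using (Σ; ∃; _×_; _,_)
open import Data.List using (List; []; _∷_)
open import Data.List.Relation.Unary.All using (All)
open import Data.List.Relation.Unary.Any using (Any)
open import Data.Nat using (ℕ; zero; suc)
open import Data.Empty using (⊥)

record Field (c ℓ : Level) : Set (lsuc (c ⊔ ℓ)) where
  field
    commutativeRing : CommutativeRing c ℓ
  open CommutativeRing commutativeRing public
  field
    0≉1     : ¬ (0# ≈ 1#)
    inverse : ∀ x → ¬ (x ≈ 0#) → ∃ λ y → (x * y) ≈ 1#

module _ {c ℓ : Level} (F : Field c ℓ) where
  open Field F

  record IsSubfield {p : Level} (K : Carrier → Set p) : Set (c ⊔ ℓ ⊔ p) where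
    field
      resp : ∀ {x y} → x ≈ y → K x → K y
      has0 : K 0#
      has1 : K 1#
      +-closed : ∀ {x y} → K x → K y → K (x + y)
      neg-closed : ∀ {x} → K x → K (- x)
      *-closed : ∀ {x y} → K x → K y → K (x * y)
      inv-closed : ∀ {x y} → K x → ¬ (x ≈ 0#) → (x * y) ≈ 1# → K y

  -- The subfield generated by two elements a, b over the prime field:
  -- the smallest subfield containing a and b, i.e. 𝔽_p(a, b).
  data Gen₂ (a b : Carrier) : Carrier → Set (c ⊔ ℓ) where
    gen-a : Gen₂ a b a
    gen-b : Gen₂ a b b
    gen-resp : ∀ {x y} → x ≈ y → Gen₂ a b x → Gen₂ a b y
    gen-0 : Gen₂ a b 0#
    gen-1 : Gen₂ a b 1#
    gen-+ : ∀ {x y} → Gen₂ a b x → Gen₂ a b y → Gen₂ a b (x + y)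
    gen-neg : ∀ {x} → Gen₂ a b x → Gen₂ a b (- x)
    gen-* : ∀ {x y} → Gen₂ a b x → Gen₂ a b y → Gen₂ a b (x * y)
    gen-inv : ∀ {x y} → Gen₂ a b x → ¬ (x ≈ 0#) → (x * y) ≈ 1# → Gen₂ a b y

  -- Polynomials as coefficient lists (constant term first); Horner evaluation.
  Poly : Set c
  Poly = List Carrier

  eval : Poly → Carrier → Carrier
  eval [] x = 0#
  eval (a ∷ as) x = a + (x * eval as x)

  NonzeroPoly : Poly → Set (c ⊔ ℓ)
  NonzeroPoly P = Any (λ a → ¬ (a ≈ 0#)) P

  Nonconstant : Poly → Set (c ⊔ ℓ)
  Nonconstant [] = Level.Lift (c ⊔ ℓ) ⊥
  Nonconstant (a ∷ as) = NonzeroPoly as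

  IsAlgebraicallyClosed : Set (c ⊔ ℓ)
  IsAlgebraicallyClosed = ∀ P → Nonconstant P → ∃ λ x → eval P x ≈ 0#

  -- x lies in the (relative) algebraic closure of the subfield K inside F:
  -- x is a root of a nonzero polynomial with coefficients in K.
  AlgebraicOver : {p : Level} → (Carrier → Set p) → Carrier → Set (c ⊔ ℓ ⊔ p)
  AlgebraicOver K x = Σ Poly λ P → All K P × NonzeroPoly P × (eval P x ≈ 0#)

  pow : Carrier → ℕ → Carrier
  pow z zero = 1#
  pow z (suc n) = z * pow z n

  fmap : ℕ → Carrier → Carrier → Carrier
  fmap d λ' z = pow z d + λ'

  iter : ℕ → Carrier → ℕ → Carrier → Carrier
  iter d λ' zero z = z
  iter d λ' (suc n) z = fmap d λ' (iter d λ' n z)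

{-# OPTIONS --safe #-}
module Submission where

-- For fixed α the value f_λ^m(α) is a polynomial Φ_m(λ) with coefficients in
-- 𝔽_p(α): Φ_0 = α and Φ_{m+1} = Φ_m^d + λ. For m ≥ 1 it is monic of degree
-- d^(m-1), since raising to the power d ≥ 2 pushes the degree past that of the
-- added λ. Hence f_λ^m(α) = β makes λ a root of the nonzero polynomial Φ_m − β
-- with coefficients in 𝔽_p(α, β).

open import Defs
open import Level using (Level; _⊔_)
open import Data.Nat as ℕ using (ℕ; zero; suc; _≤_; _<_; _≥_; z≤n; s≤s)
open import Data.Nat.Properties using (m≤n+m; ≤-trans; *-mono-≤; m^n>0)
open import Data.Product using (Σ; _×_; _,_)
open import Data.List using ([]; _∷_)
open import Data.List.Relation.Unary.All using (All; []; _∷_)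
open import Data.List.Relation.Unary.Any using (here; there)
import Algebra.Properties.CommutativeSemigroup as CommutativeSemigroupProperties
import Relation.Binary.Reasoning.Setoid as SetoidReasoning

module Polynomials {c ℓ : Level} (F : Field c ℓ) where
  open Field F hiding (zero)
  open SetoidReasoning setoid
  open CommutativeSemigroupProperties +-commutativeSemigroup using (interchange)
  open CommutativeSemigroupProperties *-commutativeSemigroup using (x∙yz≈y∙xz)

  infixl 6 _+ₚ_
  infixl 7 _·ₚ_ _*ₚ_
  infixr 8 _^ₚ_

  const : Carrier → Poly F
  const a = a ∷ []

  X : Poly F
  X = 0# ∷ 1# ∷ []

  _+ₚ_ : Poly F → Poly F → Poly F
  []      +ₚ q       = q
  (a ∷ p) +ₚ []      = a ∷ p
  (a ∷ p) +ₚ (b ∷ q) = (a + b) ∷ (p +ₚ q)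

  _·ₚ_ : Carrier → Poly F → Poly F
  a ·ₚ []      = []
  a ·ₚ (b ∷ q) = (a * b) ∷ (a ·ₚ q)

  _*ₚ_ : Poly F → Poly F → Poly F
  []      *ₚ q = []
  (a ∷ p) *ₚ q = a ·ₚ q +ₚ (0# ∷ p *ₚ q)

  _^ₚ_ : Poly F → ℕ → Poly F
  q ^ₚ zero  = const 1#
  q ^ₚ suc n = q *ₚ q ^ₚ n

  pow-cong : ∀ {u v} n → u ≈ v → pow F u n ≈ pow F v n
  pow-cong zero    u≈v = refl
  pow-cong (suc n) u≈v = *-cong u≈v (pow-cong n u≈v)

  eval-const : ∀ a x → eval F (const a) x ≈ a
  eval-const a x = begin
    a + x * 0# ≈⟨ +-congˡ (zeroʳ x) ⟩
    a + 0#     ≈⟨ +-identityʳ a ⟩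
    a          ∎

  eval-X : ∀ x → eval F X x ≈ x
  eval-X x = begin
    0# + x * (1# + x * 0#) ≈⟨ +-identityˡ _ ⟩
    x * (1# + x * 0#)      ≈⟨ *-congˡ (eval-const 1# x) ⟩
    x * 1#                 ≈⟨ *-identityʳ x ⟩
    x                      ∎

  eval-+ₚ : ∀ p q x → eval F (p +ₚ q) x ≈ eval F p x + eval F q x
  eval-+ₚ []      q       x = sym (+-identityˡ _)
  eval-+ₚ (a ∷ p) []      x = sym (+-identityʳ _)
  eval-+ₚ (a ∷ p) (b ∷ q) x = begin
    (a + b) + x * eval F (p +ₚ q) x             ≈⟨ +-congˡ (*-congˡ (eval-+ₚ p q x)) ⟩
    (a + b) + x * (eval F p x + eval F q x)     ≈⟨ +-congˡ (distribˡ x _ _) ⟩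
    (a + b) + (x * eval F p x + x * eval F q x) ≈⟨ interchange a b _ _ ⟩
    (a + x * eval F p x) + (b + x * eval F q x) ∎

  eval-·ₚ : ∀ a q x → eval F (a ·ₚ q) x ≈ a * eval F q x
  eval-·ₚ a []      x = sym (zeroʳ a)
  eval-·ₚ a (b ∷ q) x = begin
    a * b + x * eval F (a ·ₚ q) x ≈⟨ +-congˡ (*-congˡ (eval-·ₚ a q x)) ⟩
    a * b + x * (a * eval F q x)  ≈⟨ +-congˡ (x∙yz≈y∙xz x a _) ⟩
    a * b + a * (x * eval F q x)  ≈⟨ distribˡ a b _ ⟨
    a * (b + x * eval F q x)      ∎

  eval-*ₚ : ∀ p q x → eval F (p *ₚ q) x ≈ eval F p x * eval F q x
  eval-*ₚ []      q x = sym (zeroˡ _)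
  eval-*ₚ (a ∷ p) q x = begin
    eval F (a ·ₚ q +ₚ (0# ∷ p *ₚ q)) x                ≈⟨ eval-+ₚ (a ·ₚ q) _ x ⟩
    eval F (a ·ₚ q) x + (0# + x * eval F (p *ₚ q) x) ≈⟨ +-cong (eval-·ₚ a q x) (+-identityˡ _) ⟩
    a * Q + x * eval F (p *ₚ q) x                     ≈⟨ +-congˡ (*-congˡ (eval-*ₚ p q x)) ⟩
    a * Q + x * (eval F p x * Q)                      ≈⟨ +-congˡ (*-assoc x _ Q) ⟨
    a * Q + (x * eval F p x) * Q                      ≈⟨ distribʳ Q a _ ⟨
    (a + x * eval F p x) * Q                          ∎
    where
    Q : Carrier
    Q = eval F q x

  eval-^ₚ : ∀ q n x → eval F (q ^ₚ n) x ≈ pow F (eval F q x) n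
  eval-^ₚ q zero    x = eval-const 1# x
  eval-^ₚ q (suc n) x = begin
    eval F (q *ₚ q ^ₚ n) x                 ≈⟨ eval-*ₚ q (q ^ₚ n) x ⟩
    eval F q x * eval F (q ^ₚ n) x         ≈⟨ *-congˡ (eval-^ₚ q n x) ⟩
    eval F q x * pow F (eval F q x) n      ∎

  module _ {ℓ′ : Level} {K : Carrier → Set ℓ′} (K-subfield : IsSubfield F K) where
    open IsSubfield K-subfield

    +ₚ-closed : ∀ {p q} → All K p → All K q → All K (p +ₚ q)
    +ₚ-closed []        Kq        = Kq
    +ₚ-closed (Ka ∷ Kp) []        = Ka ∷ Kp
    +ₚ-closed (Ka ∷ Kp) (Kb ∷ Kq) = +-closed Ka Kb ∷ +ₚ-closed Kp Kq

    ·ₚ-closed : ∀ {a q} → K a → All K q → All K (a ·ₚ q)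
    ·ₚ-closed Ka []        = []
    ·ₚ-closed Ka (Kb ∷ Kq) = *-closed Ka Kb ∷ ·ₚ-closed Ka Kq

    *ₚ-closed : ∀ {p q} → All K p → All K q → All K (p *ₚ q)
    *ₚ-closed []        Kq = []
    *ₚ-closed (Ka ∷ Kp) Kq = +ₚ-closed (·ₚ-closed Ka Kq) (has0 ∷ *ₚ-closed Kp Kq)

    ^ₚ-closed : ∀ {q} n → All K q → All K (q ^ₚ n)
    ^ₚ-closed zero    Kq = has1 ∷ []
    ^ₚ-closed (suc n) Kq = *ₚ-closed Kq (^ₚ-closed n Kq)

  -- The coefficients of index ≥ k vanish (up to ≈).
  data DegreeBelow : ℕ → Poly F → Set (c ⊔ ℓ) where
    []     : ∀ {k} → DegreeBelow k []
    zero-∷ : ∀ {a p} → a ≈ 0# → DegreeBelow zero p → DegreeBelow zero (a ∷ p)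
    suc-∷  : ∀ {k a p} → DegreeBelow k p → DegreeBelow (suc k) (a ∷ p)

  data Monic : ℕ → Poly F → Set (c ⊔ ℓ) where
    monic-zero : ∀ {a p} → a ≈ 1# → DegreeBelow zero p → Monic zero (a ∷ p)
    monic-suc  : ∀ {k a p} → Monic k p → Monic (suc k) (a ∷ p)

  degreeBelow-mono : ∀ {j k p} → j ≤ k → DegreeBelow j p → DegreeBelow k p
  degreeBelow-mono j≤k             []              = []
  degreeBelow-mono {k = zero}  z≤n (zero-∷ a≈0 p≈0) = zero-∷ a≈0 p≈0
  degreeBelow-mono {k = suc k} z≤n (zero-∷ a≈0 p≈0) = suc-∷ (degreeBelow-mono z≤n p≈0)
  degreeBelow-mono (s≤s j≤k)       (suc-∷ p<j)      = suc-∷ (degreeBelow-mono j≤k p<j)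

  monic⇒degreeBelow : ∀ {k p} → Monic k p → DegreeBelow (suc k) p
  monic⇒degreeBelow (monic-zero _ p≈0)  = suc-∷ (degreeBelow-mono z≤n p≈0)
  monic⇒degreeBelow (monic-suc p-monic) = suc-∷ (monic⇒degreeBelow p-monic)

  monic⇒nonzero : ∀ {k p} → Monic k p → NonzeroPoly F p
  monic⇒nonzero (monic-zero a≈1 _)  = here (λ a≈0 → 0≉1 (trans (sym a≈0) a≈1))
  monic⇒nonzero (monic-suc p-monic) = there (monic⇒nonzero p-monic)

  degreeBelow-+ₚ : ∀ {k p q} → DegreeBelow k p → DegreeBelow k q → DegreeBelow k (p +ₚ q)
  degreeBelow-+ₚ []               q<k              = q<k
  degreeBelow-+ₚ (zero-∷ a≈0 p≈0) []               = zero-∷ a≈0 p≈0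
  degreeBelow-+ₚ (suc-∷ p<k)      []               = suc-∷ p<k
  degreeBelow-+ₚ (zero-∷ a≈0 p≈0) (zero-∷ b≈0 q≈0) =
    zero-∷ (trans (+-cong a≈0 b≈0) (+-identityˡ 0#)) (degreeBelow-+ₚ p≈0 q≈0)
  degreeBelow-+ₚ (suc-∷ p<k)      (suc-∷ q<k)      = suc-∷ (degreeBelow-+ₚ p<k q<k)

  degreeBelow-·ₚ : ∀ {k} a {q} → DegreeBelow k q → DegreeBelow k (a ·ₚ q)
  degreeBelow-·ₚ a []               = []
  degreeBelow-·ₚ a (zero-∷ b≈0 q≈0) = zero-∷ (trans (*-congˡ b≈0) (zeroʳ a)) (degreeBelow-·ₚ a q≈0)
  degreeBelow-·ₚ a (suc-∷ q<k)      = suc-∷ (degreeBelow-·ₚ a q<k)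

  zero-·ₚ : ∀ {a} q → a ≈ 0# → DegreeBelow zero (a ·ₚ q)
  zero-·ₚ []      a≈0 = []
  zero-·ₚ (b ∷ q) a≈0 = zero-∷ (trans (*-congʳ a≈0) (zeroˡ b)) (zero-·ₚ q a≈0)

  zero-*ₚ : ∀ {p} q → DegreeBelow zero p → DegreeBelow zero (p *ₚ q)
  zero-*ₚ q []               = []
  zero-*ₚ q (zero-∷ a≈0 p≈0) = degreeBelow-+ₚ (zero-·ₚ q a≈0) (zero-∷ refl (zero-*ₚ q p≈0))

  constant-*ₚ : ∀ {p q} → DegreeBelow 1 p → DegreeBelow 1 q → DegreeBelow 1 (p *ₚ q)
  constant-*ₚ []                    q<1 = []
  constant-*ₚ {a ∷ _} {q} (suc-∷ p≈0) q<1 =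
    degreeBelow-+ₚ (degreeBelow-·ₚ a q<1) (suc-∷ (zero-*ₚ q p≈0))

  constant-^ₚ : ∀ {q} n → DegreeBelow 1 q → DegreeBelow 1 (q ^ₚ n)
  constant-^ₚ zero    q<1 = suc-∷ []
  constant-^ₚ (suc n) q<1 = constant-*ₚ q<1 (constant-^ₚ n q<1)

  monic-·ₚ : ∀ {a k q} → a ≈ 1# → Monic k q → Monic k (a ·ₚ q)
  monic-·ₚ {a} a≈1 (monic-zero b≈1 q≈0) =
    monic-zero (trans (*-cong a≈1 b≈1) (*-identityˡ 1#)) (degreeBelow-·ₚ a q≈0)
  monic-·ₚ a≈1 (monic-suc q-monic) = monic-suc (monic-·ₚ a≈1 q-monic)

  monic-+ₚʳ : ∀ {k p q} → Monic k p → DegreeBelow k q → Monic k (p +ₚ q)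
  monic-+ₚʳ p-monic@(monic-zero _ _) []               = p-monic
  monic-+ₚʳ p-monic@(monic-suc _)    []               = p-monic
  monic-+ₚʳ (monic-zero a≈1 p≈0)     (zero-∷ b≈0 q≈0) =
    monic-zero (trans (+-cong a≈1 b≈0) (+-identityʳ 1#)) (degreeBelow-+ₚ p≈0 q≈0)
  monic-+ₚʳ (monic-suc p-monic)      (suc-∷ q<k)      = monic-suc (monic-+ₚʳ p-monic q<k)

  monic-+ₚˡ : ∀ {k p q} → DegreeBelow k p → Monic k q → Monic k (p +ₚ q)
  monic-+ₚˡ []               q-monic              = q-monic
  monic-+ₚˡ (zero-∷ a≈0 p≈0) (monic-zero b≈1 q≈0) =
    monic-zero (trans (+-cong a≈0 b≈1) (+-identityˡ 1#)) (degreeBelow-+ₚ p≈0 q≈0)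
  monic-+ₚˡ (suc-∷ p<k)      (monic-suc q-monic)  = monic-suc (monic-+ₚˡ p<k q-monic)

  monic-*ₚ : ∀ {j k p q} → Monic j p → Monic k q → Monic (j ℕ.+ k) (p *ₚ q)
  monic-*ₚ {q = q} (monic-zero a≈1 p≈0) q-monic =
    monic-+ₚʳ (monic-·ₚ a≈1 q-monic) (degreeBelow-mono z≤n (zero-∷ refl (zero-*ₚ q p≈0)))
  monic-*ₚ {suc j} {k} {a ∷ _} (monic-suc p-monic) q-monic =
    monic-+ₚˡ (degreeBelow-·ₚ a (degreeBelow-mono (s≤s (m≤n+m k j)) (monic⇒degreeBelow q-monic)))
              (monic-suc (monic-*ₚ p-monic q-monic))

  monic-^ₚ : ∀ {k q} n → Monic k q → Monic (n ℕ.* k) (q ^ₚ n)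
  monic-^ₚ zero    q-monic = monic-zero refl []
  monic-^ₚ (suc n) q-monic = monic-*ₚ q-monic (monic-^ₚ n q-monic)

Gen₂-isSubfield : ∀ {c ℓ} (F : Field c ℓ) a b → IsSubfield F (Gen₂ F a b)
Gen₂-isSubfield F a b = record
  { resp       = gen-resp
  ; has0       = gen-0
  ; has1       = gen-1
  ; +-closed   = gen-+
  ; neg-closed = gen-neg
  ; *-closed   = gen-*
  ; inv-closed = gen-inv
  }

module Iteration {c ℓ : Level} (F : Field c ℓ) (d : ℕ) where
  open Field F hiding (zero)
  open Polynomials F
  open SetoidReasoning setoid

  d^m≥1 : d ≥ 2 → ∀ m → d ℕ.^ m ≥ 1
  d^m≥1 d≥2 = m^n>0 d {{ℕ.>-nonZero (≤-trans (s≤s z≤n) d≥2)}}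

  iterPoly : Carrier → ℕ → Poly F
  iterPoly α zero    = const α
  iterPoly α (suc m) = iterPoly α m ^ₚ d +ₚ X

  eval-iterPoly : ∀ α m x → eval F (iterPoly α m) x ≈ iter F d x m α
  eval-iterPoly α zero    x = eval-const α x
  eval-iterPoly α (suc m) x = begin
    eval F (iterPoly α m ^ₚ d +ₚ X) x                 ≈⟨ eval-+ₚ (iterPoly α m ^ₚ d) X x ⟩
    eval F (iterPoly α m ^ₚ d) x + eval F X x         ≈⟨ +-cong (eval-^ₚ (iterPoly α m) d x) (eval-X x) ⟩
    pow F (eval F (iterPoly α m) x) d + x             ≈⟨ +-congʳ (pow-cong d (eval-iterPoly α m x)) ⟩
    pow F (iter F d x m α) d + x                      ∎

  iterPoly-closed : ∀ {ℓ′} {K : Carrier → Set ℓ′} → IsSubfield F K →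
                    ∀ {α} → K α → ∀ m → All K (iterPoly α m)
  iterPoly-closed K-subfield Kα zero    = Kα ∷ []
  iterPoly-closed K-subfield Kα (suc m) =
    +ₚ-closed K-subfield (^ₚ-closed K-subfield d (iterPoly-closed K-subfield Kα m)) (has0 ∷ has1 ∷ [])
    where open IsSubfield K-subfield

  iterPoly-monic : d ≥ 2 → ∀ α m → Monic (d ℕ.^ m) (iterPoly α (suc m))
  iterPoly-monic d≥2 α zero    = monic-+ₚˡ (constant-^ₚ d (suc-∷ [])) (monic-suc (monic-zero refl []))
  iterPoly-monic d≥2 α (suc m) =
    monic-+ₚʳ (monic-^ₚ d (iterPoly-monic d≥2 α m))
              (degreeBelow-mono (*-mono-≤ d≥2 (d^m≥1 d≥2 m)) (suc-∷ (suc-∷ [])))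

  iterate-hits⇒algebraic : ∀ {ℓ′} {K : Carrier → Set ℓ′} → IsSubfield F K → d ≥ 2 →
                           ∀ {α β} → K α → K β → ∀ λ' m →
                           iter F d λ' (suc m) α ≈ β → AlgebraicOver F K λ'
  iterate-hits⇒algebraic K-subfield d≥2 {α} {β} Kα Kβ λ' m hits =
    P , +ₚ-closed K-subfield (iterPoly-closed K-subfield Kα (suc m)) (neg-closed Kβ ∷ []) ,
    monic⇒nonzero (monic-+ₚʳ (iterPoly-monic d≥2 α m) (degreeBelow-mono (d^m≥1 d≥2 m) (suc-∷ []))) ,
    (begin
      eval F P λ'                                               ≈⟨ eval-+ₚ (iterPoly α (suc m)) (const (- β)) λ' ⟩
      eval F (iterPoly α (suc m)) λ' + eval F (const (- β)) λ'  ≈⟨ +-cong (eval-iterPoly α (suc m) λ') (eval-const (- β) λ') ⟩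
      iter F d λ' (suc m) α - β                                 ≈⟨ +-congʳ hits ⟩
      β - β                                                     ≈⟨ -‿inverseʳ β ⟩
      0#                                                        ∎)
    where
    open IsSubfield K-subfield
    P : Poly F
    P = iterPoly α (suc m) +ₚ const (- β)

lemma3p4 : {c ℓ p : Level} (Lbar : Field c ℓ) → IsAlgebraicallyClosed Lbar
         → (L : Field.Carrier Lbar → Set p) → IsSubfield Lbar L
         → (d : ℕ) → d ≥ 2
         → (α₁ α₂ β : Field.Carrier Lbar) → L α₁ → L α₂ → L β
         → (λ' : Field.Carrier Lbar)
         → (Σ ℕ λ m → Σ ℕ λ n → 0 < m × 0 < n
              × Field._≈_ Lbar (iter Lbar d λ' m α₁) β
              × Field._≈_ Lbar (iter Lbar d λ' n α₂) β)
         → AlgebraicOver Lbar (Gen₂ Lbar α₁ β) λ' × AlgebraicOver Lbar (Gen₂ Lbar α₂ β) λ'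
lemma3p4 Lbar _ _ _ d d≥2 α₁ α₂ β _ _ _ λ' (suc m , suc n , _ , _ , hits₁ , hits₂) =
  iterate-hits⇒algebraic (Gen₂-isSubfield Lbar α₁ β) d≥2 gen-a gen-b λ' m hits₁ ,
  iterate-hits⇒algebraic (Gen₂-isSubfield Lbar α₂ β) d≥2 gen-a gen-b λ' n hits₂
  where open Iteration Lbar d
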